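{- If $G$ is a cograph, then there is a partition of $V(G)$ into two disjoint sets $X,Y$ with $X\cup Y=V(G)$ such that $X$ is thin and $Y$ is thick.
   Context: All graphs are finite and simple; $G[X]$ is the induced subgraph on $X$, $\overline{G}$ the complement. A cograph is a graph with no induced subgraph isomorphic to $P_4$ (the path on four vertices). A set $X\subseteq V(G)$ is thin if every connected component of $G[X]$ has at most $(|X|+1)/2$ vertices, and thick if every connected component of $\overline{G}[X]$ has at most $(|X|+1)/2$ vertices. -}

module Defs where

open import Data.Nat using (ℕ; suc; _+_; _*_; _≤_)
open import Data.Fin using (Fin)
open import Data.Fin.Subset using (Subset; _∈_; _∉_; _⊆_; ∣_∣; Nonempty)
open import Data.Bool using (Bool; true; false; not; _∧_)
open import Data.Product using (_×_)
open import Relation.Binary.PropositionalEquality using (_≡_; _≢_)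
open import Relation.Nullary using (¬_)
open import Relation.Nullary.Decidable using (⌊_⌋)
open import Data.Fin using (_≟_)

record Graph (n : ℕ) : Set where
  field
    adj    : Fin n → Fin n → Bool
    adj-sym    : ∀ u v → adj u v ≡ adj v u
    adj-irrefl : ∀ v → adj v v ≡ false
open Graph public

Adj : ∀ {n} → Graph n → Fin n → Fin n → Set
Adj G u v = adj G u v ≡ true

complement : ∀ {n} → Graph n → Graph n
complement {n} G = record
  { adj = λ u v → not (⌊ u ≟ v ⌋) ∧ not (adj G u v)
  ; adj-sym = symC
  ; adj-irrefl = irr
  }
  where
  open import Relation.Binary.PropositionalEquality using (refl; cong₂; sym)
  eqsym : ∀ (u v : Fin n) → ⌊ u ≟ v ⌋ ≡ ⌊ v ≟ u ⌋
  eqsym u v with u ≟ v | v ≟ u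
  ... | Relation.Nullary.yes _ | Relation.Nullary.yes _ = refl
  ... | Relation.Nullary.no _  | Relation.Nullary.no _  = refl
  ... | Relation.Nullary.yes p | Relation.Nullary.no q = Data.Empty.⊥-elim (q (sym p))
    where import Data.Empty
  ... | Relation.Nullary.no p  | Relation.Nullary.yes q = Data.Empty.⊥-elim (p (sym q))
    where import Data.Empty
  symC : ∀ u v → not ⌊ u ≟ v ⌋ ∧ not (adj G u v) ≡ not ⌊ v ≟ u ⌋ ∧ not (adj G v u)
  symC u v = cong₂ (λ a b → not a ∧ not b) (eqsym u v) (Graph.adj-sym G u v)
  irr : ∀ v → not ⌊ v ≟ v ⌋ ∧ not (adj G v v) ≡ false
  irr v with v ≟ v
  ... | Relation.Nullary.yes _ = refl
  ... | Relation.Nullary.no ¬p = Data.Empty.⊥-elim (¬p refl)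
    where import Data.Empty

IsInducedP4 : ∀ {n} → Graph n → Fin n → Fin n → Fin n → Fin n → Set
IsInducedP4 G a b c d =
  a ≢ b × a ≢ c × a ≢ d × b ≢ c × b ≢ d × c ≢ d ×
  Adj G a b × Adj G b c × Adj G c d ×
  ¬ Adj G a c × ¬ Adj G a d × ¬ Adj G b d

IsCograph : ∀ {n} → Graph n → Set
IsCograph G = ∀ a b c d → ¬ IsInducedP4 G a b c d

data Walk {n} (G : Graph n) (S : Subset n) : Fin n → Fin n → Set where
  here : ∀ {u} → u ∈ S → Walk G S u u
  step : ∀ {u w v} → u ∈ S → Adj G u w → Walk G S w v → Walk G S u v

-- C is a connected component of G[X]: a nonempty subset of X, connected
-- in G[C], and closed under adjacency inside X (hence maximal connected).
IsComponent : ∀ {n} → Graph n → Subset n → Subset n → Set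
IsComponent G X C =
  C ⊆ X × Nonempty C ×
  (∀ {u v} → u ∈ C → v ∈ C → Walk G C u v) ×
  (∀ {u v} → u ∈ C → v ∈ X → Adj G u v → v ∈ C)

-- X is thin: every component of G[X] has at most (|X|+1)/2 vertices,
-- i.e. 2·|C| ≤ |X| + 1.
Thin : ∀ {n} → Graph n → Subset n → Set
Thin G X = ∀ C → IsComponent G X C → 2 * ∣ C ∣ ≤ ∣ X ∣ + 1

Thick : ∀ {n} → Graph n → Subset n → Set
Thick G X = Thin (complement G) X

-- Strengthen the statement: for W ⊆ V(G) and numbers γ < α, δ < β with γ + δ ≤ |W|, there is
-- a partition W = X ⊔ Y such that every component C of G[X] has 2|C| ≤ |X| + α, every
-- component D of Ḡ[Y] has 2|D| ≤ |Y| + β, |X| ≥ γ and |Y| ≥ δ (the theorem is α = β = 1,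
-- γ = δ = 0). If |W| ≤ α + β, any X with |X| ≤ α and |Y| ≤ β of suitable
-- size works. Otherwise, by Seinsche's theorem G[W] or Ḡ[W] is disconnected; the two cases
-- are exchanged by complementing and swapping X with Y, so let W = A ⊔ B with no edges of G
-- between A and B. If A is much larger than B (|A| > |B| + α + β), solve A inductively with
-- α + |B| and γ + |B| in place of α and γ and add all of B to X. Otherwise X consists of two
-- pieces of A and B whose sizes differ by at most α, and the remaining y ≤ β vertices form
-- Y; Ḡ[Y] may well be connected, but it is small.
--
-- Seinsche's theorem (a cograph on at least two vertices is disconnected or has a
-- disconnected complement) is proved by removing a vertex v, splitting the rest inductively
-- and putting v back; the only obstruction to doing so is an induced P₄.

module Submission where

open import Defs
open import Data.Bool using (true; false)
import Data.Bool as Bool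
open import Data.Fin using (Fin; zero; suc; _≟_)
open import Data.Fin.Properties using (suc-injective)
open import Data.Fin.Subset
open import Data.Fin.Subset.Properties
  using ( _∈?_; nonempty?; drop-there; ∉⊥; ∈⊤; ∣⊥∣≡0; ⊆-antisym
        ; x∈⁅x⁆; x∈⁅y⁆⇒x≡y; x≢y⇒x∉⁅y⁆; x∉p⇒x∈∁p; x∈∁p⇒x∉p
        ; x∈p∩q⁺; x∈p∩q⁻; p⊆p∪q; q⊆p∪q; x∈p∪q⁺; x∈p∪q⁻; ∪-identityˡ
        ; x∈p∧x∉q⇒x∈p─q; p─q⊆p; x∈p⇒∣p-x∣<∣p∣; p⊆q⇒∣p∣≤∣q∣; p⊂q⇒∣p∣<∣q∣ )
open import Data.Nat using (ℕ; zero; suc; _+_; _*_; _≤_; _<_; z≤n; s≤s; _≤?_)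
open import Data.Nat.Induction using (<-wellFounded)
open import Data.Nat.Properties
  using ( ≤-refl; ≤-reflexive; ≤-trans; ≤-total; ≤-pred; <⇒≤; ≰⇒>; module ≤-Reasoning
        ; +-comm; +-assoc; +-suc; +-identityʳ; +-commutativeSemigroup
        ; +-mono-≤; +-monoˡ-≤; +-monoʳ-≤; +-monoˡ-<; m≤m+n; m≤n+m; m+n≤o⇒n≤o; m≤n⇒∃[o]m+o≡n
        ; +-cancelˡ-≡; +-cancelʳ-≤; +-cancelʳ-< )
open import Algebra.Properties.CommutativeSemigroup +-commutativeSemigroup using (interchange)
open import Data.Product using (Σ; ∃; ∃₂; _×_; _,_; proj₁; proj₂)
open import Data.Sum using (_⊎_; inj₁; inj₂; [_,_]′)
import Data.Sum as Sum
open import Data.Vec using ([]; _∷_; here; there; tabulate)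
open import Data.Vec.Properties using (lookup∘tabulate; []=⇒lookup; lookup⇒[]=)
open import Function using (_∘_; id)
open import Induction.WellFounded using (WellFounded; Acc; acc)
import Relation.Binary.Construct.On as On
open import Relation.Binary.PropositionalEquality
open import Relation.Nullary using (¬_; yes; no; contradiction)

-- Partitions of a vertex set

private variable
  n : ℕ
  x y : Fin n
  p W A B A₁ A₂ B₁ B₂ X Y : Subset n

x∈p─q⇒x∉q : ∀ (p q : Subset n) → x ∈ p ─ q → x ∉ q
x∈p─q⇒x∉q (s ∷ p) (outside ∷ q) here ()
x∈p─q⇒x∉q (s ∷ p) (t ∷ q) (there x∈p─q) (there x∈q) = x∈p─q⇒x∉q p q x∈p─q x∈q

record Partition (W A B : Subset n) : Set where
  field
    left⊆    : A ⊆ W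
    right⊆   : B ⊆ W
    cover    : x ∈ W → x ∈ A ⊎ x ∈ B
    disjoint : x ∈ A → x ∉ B
open Partition

swap-partition : Partition W A B → Partition W B A
swap-partition P = record
  { left⊆ = right⊆ P ; right⊆ = left⊆ P
  ; cover = λ x∈W → Sum.swap (cover P x∈W)
  ; disjoint = λ x∈B x∈A → disjoint P x∈A x∈B }

trivial-partition : Partition W W ⊥
trivial-partition = record
  { left⊆ = λ x∈W → x∈W ; right⊆ = λ x∈⊥ → contradiction x∈⊥ ∉⊥
  ; cover = inj₁ ; disjoint = λ _ → ∉⊥ }

difference-partition : A ⊆ W → Partition W A (W ─ A)
difference-partition {A = A} {W = W} A⊆W = record
  { left⊆ = A⊆W ; right⊆ = p─q⊆p W A
  ; cover = cover′ ; disjoint = λ x∈A x∈W─A → x∈p─q⇒x∉q W A x∈W─A x∈A }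
  where
  cover′ : x ∈ W → x ∈ A ⊎ x ∈ W ─ A
  cover′ {x = x} x∈W with x ∈? A
  ... | yes x∈A = inj₁ x∈A
  ... | no  x∉A = inj₂ (x∈p∧x∉q⇒x∈p─q x∈W x∉A)

union-partition : (∀ {x} → x ∈ A → x ∉ B) → Partition (A ∪ B) A B
union-partition {A = A} {B = B} A∩B≡∅ = record
  { left⊆ = p⊆p∪q B ; right⊆ = q⊆p∪q A B
  ; cover = x∈p∪q⁻ A B ; disjoint = A∩B≡∅ }

merge-partitions : Partition W A B → Partition A A₁ A₂ → Partition B B₁ B₂ →
                   Partition W (A₁ ∪ B₁) (A₂ ∪ B₂)
merge-partitions {W = W} {A₁ = A₁} {A₂ = A₂} {B₁ = B₁} {B₂ = B₂} P PA PB = record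
  { left⊆ = λ x∈ → [ left⊆ P ∘ left⊆ PA , right⊆ P ∘ left⊆ PB ]′ (x∈p∪q⁻ A₁ B₁ x∈)
  ; right⊆ = λ x∈ → [ left⊆ P ∘ right⊆ PA , right⊆ P ∘ right⊆ PB ]′ (x∈p∪q⁻ A₂ B₂ x∈)
  ; cover = cover′
  ; disjoint = λ x∈₁ x∈₂ → disjoint′ (x∈p∪q⁻ A₁ B₁ x∈₁) (x∈p∪q⁻ A₂ B₂ x∈₂) }
  where
  cover′ : x ∈ W → x ∈ A₁ ∪ B₁ ⊎ x ∈ A₂ ∪ B₂
  cover′ x∈W with cover P x∈W
  ... | inj₁ x∈A = Sum.map (x∈p∪q⁺ ∘ inj₁) (x∈p∪q⁺ ∘ inj₁) (cover PA x∈A)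
  ... | inj₂ x∈B = Sum.map (x∈p∪q⁺ ∘ inj₂) (x∈p∪q⁺ ∘ inj₂) (cover PB x∈B)
  disjoint′ : x ∈ A₁ ⊎ x ∈ B₁ → ¬ (x ∈ A₂ ⊎ x ∈ B₂)
  disjoint′ (inj₁ x∈A₁) (inj₁ x∈A₂) = disjoint PA x∈A₁ x∈A₂
  disjoint′ (inj₁ x∈A₁) (inj₂ x∈B₂) = disjoint P (left⊆ PA x∈A₁) (right⊆ PB x∈B₂)
  disjoint′ (inj₂ x∈B₁) (inj₁ x∈A₂) = disjoint P (right⊆ PA x∈A₂) (left⊆ PB x∈B₁)
  disjoint′ (inj₂ x∈B₁) (inj₂ x∈B₂) = disjoint PB x∈B₁ x∈B₂

refine-partition : Partition W A B → Partition B B₁ B₂ → Partition W (A ∪ B₁) B₂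
refine-partition {B₂ = B₂} P PB =
  subst (Partition _ _) (∪-identityˡ B₂) (merge-partitions P trivial-partition PB)

tail-partition : ∀ {s a b} → Partition (s ∷ W) (a ∷ A) (b ∷ B) → Partition W A B
tail-partition P = record
  { left⊆ = drop-there ∘ left⊆ P ∘ there
  ; right⊆ = drop-there ∘ right⊆ P ∘ there
  ; cover = Sum.map drop-there drop-there ∘ cover P ∘ there
  ; disjoint = λ x∈A x∈B → disjoint P (there x∈A) (there x∈B) }

partition-size : Partition W A B → ∣ A ∣ + ∣ B ∣ ≡ ∣ W ∣
partition-size {W = []} {[]} {[]} P = refl
partition-size {W = outside ∷ W} {outside ∷ A} {outside ∷ B} P =
  partition-size (tail-partition P)
partition-size {W = inside ∷ W} {inside ∷ A} {outside ∷ B} P =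
  cong suc (partition-size (tail-partition P))
partition-size {W = inside ∷ W} {outside ∷ A} {inside ∷ B} P =
  trans (+-suc ∣ A ∣ ∣ B ∣) (cong suc (partition-size (tail-partition P)))
partition-size {W = inside ∷ W} {inside ∷ A} {inside ∷ B} P = contradiction here (disjoint P here)
partition-size {W = inside ∷ W} {outside ∷ A} {outside ∷ B} P with cover P here
... | inj₁ ()
... | inj₂ ()
partition-size {W = outside ∷ W} {inside ∷ A} P with left⊆ P here
... | ()
partition-size {W = outside ∷ W} {outside ∷ A} {inside ∷ B} P with right⊆ P here
... | ()

disjoint-union-size : (∀ {x} → x ∈ A → x ∉ B) → ∣ A ∪ B ∣ ≡ ∣ A ∣ + ∣ B ∣
disjoint-union-size A∩B≡∅ = sym (partition-size (union-partition A∩B≡∅))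

partition-⊤ : Partition ⊤ X Y → Y ≡ ∁ X
partition-⊤ P = ⊆-antisym
  (λ x∈Y → x∉p⇒x∈∁p (λ x∈X → disjoint P x∈X x∈Y))
  (λ x∈∁X → [ (λ x∈X → contradiction x∈X (x∈∁p⇒x∉p x∈∁X)) , id ]′ (cover P ∈⊤))

partition-shrinks : Partition W A B → Nonempty B → ∣ A ∣ < ∣ W ∣
partition-shrinks P (x , x∈B) =
  p⊂q⇒∣p∣<∣q∣ (left⊆ P , x , right⊆ P x∈B , λ x∈A → disjoint P x∈A x∈B)

subset-of-size : ∀ (W : Subset n) {k} → k ≤ ∣ W ∣ → ∃ λ X → X ⊆ W × ∣ X ∣ ≡ k
subset-of-size [] {zero} _ = [] , (λ ()) , refl
subset-of-size (outside ∷ W) k≤ with subset-of-size W k≤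
... | X , X⊆W , ∣X∣≡k = outside ∷ X , (λ { (there x∈X) → there (X⊆W x∈X) }) , ∣X∣≡k
subset-of-size (inside ∷ W) {zero} _ with subset-of-size W z≤n
... | X , X⊆W , ∣X∣≡0 = outside ∷ X , (λ { (there x∈X) → there (X⊆W x∈X) }) , ∣X∣≡0
subset-of-size (inside ∷ W) {suc k} (s≤s k≤) with subset-of-size W k≤
... | X , X⊆W , ∣X∣≡k =
  inside ∷ X , (λ { here → here ; (there x∈X) → there (X⊆W x∈X) }) , cong suc ∣X∣≡k

partition-of-sizes : ∀ (W : Subset n) k l → k + l ≡ ∣ W ∣ →
  ∃₂ λ X Y → Partition W X Y × ∣ X ∣ ≡ k × ∣ Y ∣ ≡ l
partition-of-sizes W k l k+l≡∣W∣
  with subset-of-size W (subst (k ≤_) k+l≡∣W∣ (m≤m+n k l))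
... | X , X⊆W , ∣X∣≡k = X , W ─ X , P , ∣X∣≡k ,
  +-cancelˡ-≡ k _ _ (trans (subst (λ m → m + ∣ W ─ X ∣ ≡ ∣ W ∣) ∣X∣≡k (partition-size P))
                           (sym k+l≡∣W∣))
  where P = difference-partition X⊆W

nonempty-of-size : ∀ (W : Subset n) → 1 ≤ ∣ W ∣ → Nonempty W
nonempty-of-size (inside ∷ W) _ = zero , here
nonempty-of-size (outside ∷ W) 1≤∣W∣ with nonempty-of-size W 1≤∣W∣
... | x , x∈W = suc x , there x∈W

two-elements-of-size : ∀ (W : Subset n) → 2 ≤ ∣ W ∣ → ∃₂ λ x y → x ∈ W × y ∈ W × x ≢ y
two-elements-of-size (inside ∷ W) (s≤s 1≤∣W∣) with nonempty-of-size W 1≤∣W∣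
... | y , y∈W = zero , suc y , here , there y∈W , λ ()
two-elements-of-size (outside ∷ W) 2≤∣W∣ with two-elements-of-size W 2≤∣W∣
... | x , y , x∈W , y∈W , x≢y = suc x , suc y , there x∈W , there y∈W , x≢y ∘ suc-injective

-- Complements

private variable
  G : Graph n
  u v : Fin n
  C K S : Subset n

Adj-sym : ∀ (G : Graph n) → Adj G u v → Adj G v u
Adj-sym {u = u} {v = v} G uv = trans (adj-sym G v u) uv

Adj⇒≢ : ∀ (G : Graph n) → Adj G u v → u ≢ v
Adj⇒≢ {u = u} G uv refl = contradiction (trans (sym uv) (adj-irrefl G u)) λ ()

complement-Adj⁺ : ∀ (G : Graph n) → u ≢ v → ¬ Adj G u v → Adj (complement G) u v
complement-Adj⁺ {u = u} {v = v} G u≢v ¬uv with u ≟ v | adj G u v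
... | yes u≡v | _     = contradiction u≡v u≢v
... | no  _   | false = refl
... | no  _   | true  = contradiction refl ¬uv

complement-Adj⁻ : ∀ (G : Graph n) → Adj (complement G) u v → u ≢ v × ¬ Adj G u v
complement-Adj⁻ {u = u} {v = v} G uv with u ≟ v | adj G u v
complement-Adj⁻ G () | yes _ | _
complement-Adj⁻ G uv | no u≢v | false = u≢v , λ ()
complement-Adj⁻ G () | no _ | true

complement-¬Adj : ∀ (G : Graph n) → u ≢ v → ¬ Adj (complement G) u v → Adj G u v
complement-¬Adj {u = u} {v = v} G u≢v ¬uv with adj G u v Bool.≟ true
... | yes uv  = uv
... | no  ¬uv′ = contradiction (complement-Adj⁺ G u≢v ¬uv′) ¬uv

complement-involutive : ∀ (G : Graph n) u v → adj (complement (complement G)) u v ≡ adj G u v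
complement-involutive G u v with u ≟ v
... | yes refl = sym (adj-irrefl G u)
... | no  _ with adj G u v
...   | true  = refl
...   | false = refl

-- P₄ is self-complementary: the complement of the path a–b–c–d is the path c–a–d–b.
complement-cograph : ∀ (G : Graph n) → IsCograph G → IsCograph (complement G)
complement-cograph G cograph a b c d
  (a≢b , a≢c , a≢d , b≢c , b≢d , c≢d , ab , bc , cd , ¬ac , ¬ad , ¬bd) =
  cograph c a d b
    ( a≢c ∘ sym , c≢d , b≢c ∘ sym , a≢d , a≢b , b≢d ∘ sym
    , Adj-sym G (complement-¬Adj G a≢c ¬ac) , complement-¬Adj G a≢d ¬ad
    , Adj-sym G (complement-¬Adj G b≢d ¬bd)
    , proj₂ (complement-Adj⁻ G cd) , proj₂ (complement-Adj⁻ G bc) ∘ Adj-sym G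
    , proj₂ (complement-Adj⁻ G ab) )

-- Components

Closed : Graph n → Subset n → Subset n → Set
Closed G X K = ∀ {u v} → u ∈ K → v ∈ X → Adj G u v → v ∈ K

Separated : Graph n → Subset n → Subset n → Set
Separated G A B = ∀ {u v} → u ∈ A → v ∈ B → ¬ Adj G u v

separated-sym : ∀ (G : Graph n) → Separated G A B → Separated G B A
separated-sym G sep u∈B v∈A uv = sep v∈A u∈B (Adj-sym G uv)

separated-closed : ∀ (G : Graph n) → Partition W A B → Separated G A B → Closed G W A
separated-closed G P sep u∈A v∈W uv =
  [ (λ v∈A → v∈A) , (λ v∈B → contradiction uv (sep u∈A v∈B)) ]′ (cover P v∈W)

walk-source : Walk G S u v → u ∈ S
walk-source (here u∈S)     = u∈S
walk-source (step u∈S _ _) = u∈S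

walk-closed : S ⊆ X → Closed G X K → Walk G S u v → u ∈ K → v ∈ K
walk-closed S⊆X closed (here _)          u∈K = u∈K
walk-closed S⊆X closed (step _ uw walk) u∈K =
  walk-closed S⊆X closed walk (closed u∈K (S⊆X (walk-source walk)) uw)

component-restrict : K ⊆ X → Closed G X K → IsComponent G X C → u ∈ C → u ∈ K →
                     IsComponent G K C
component-restrict K⊆X closed (C⊆X , nonempty , connected , maximal) u∈C u∈K =
  (λ w∈C → walk-closed C⊆X closed (connected u∈C w∈C) u∈K) , nonempty , connected ,
  λ v∈C w∈K vw → maximal v∈C (K⊆X w∈K) vw

separated-component : ∀ (G : Graph n) → Partition X A B → Separated G A B →
  IsComponent G X C → IsComponent G A C ⊎ IsComponent G B C
separated-component G P sep component@(C⊆X , (u , u∈C) , _) with cover P (C⊆X u∈C)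
... | inj₁ u∈A = inj₁ (component-restrict {G = G} (left⊆ P)
  (separated-closed G P sep) component u∈C u∈A)
... | inj₂ u∈B = inj₂ (component-restrict {G = G} (right⊆ P)
  (separated-closed G (swap-partition P) (separated-sym G sep)) component u∈C u∈B)

component-size : IsComponent G X C → ∣ C ∣ ≤ ∣ X ∣
component-size (C⊆X , _) = p⊆q⇒∣p∣≤∣q∣ C⊆X

module _ {G H : Graph n} (adj≡ : ∀ u v → adj G u v ≡ adj H u v) where

  walk-cong : Walk G S u v → Walk H S u v
  walk-cong (here u∈S)                 = here u∈S
  walk-cong (step {u} {w} u∈S uw walk) = step u∈S (trans (sym (adj≡ u w)) uw) (walk-cong walk)

  component-cong : IsComponent G X C → IsComponent H X C
  component-cong (C⊆X , nonempty , connected , maximal) =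
    C⊆X , nonempty , (λ u∈C v∈C → walk-cong (connected u∈C v∈C)) ,
    λ {u} {v} u∈C v∈X uv → maximal u∈C v∈X (trans (adj≡ u v) uv)

ThinBy : ℕ → Graph n → Subset n → Set
ThinBy α G X = ∀ C → IsComponent G X C → 2 * ∣ C ∣ ≤ ∣ X ∣ + α

2*m≤n+o : ∀ {c a b} → c ≤ a → c ≤ b → 2 * c ≤ a + b
2*m≤n+o {c} c≤a c≤b = +-mono-≤ c≤a (subst (_≤ _) (sym (+-identityʳ c)) c≤b)

thinBy-small : ∀ {α} (G : Graph n) → ∣ X ∣ ≤ α → ThinBy α G X
thinBy-small G ∣X∣≤α C component =
  2*m≤n+o (component-size component) (≤-trans (component-size component) ∣X∣≤α)

thinBy-separated : ∀ {α} (G : Graph n) → Partition X A B → Separated G A B →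
  (∀ C → IsComponent G A C → 2 * ∣ C ∣ ≤ ∣ X ∣ + α) →
  (∀ C → IsComponent G B C → 2 * ∣ C ∣ ≤ ∣ X ∣ + α) → ThinBy α G X
thinBy-separated G P sep boundA boundB C component =
  [ boundA C , boundB C ]′ (separated-component G P sep component)

thinBy-complement-involutive : ∀ {α} (G : Graph n) → ThinBy α (complement (complement G)) X →
                               ThinBy α G X
thinBy-complement-involutive G thin C component =
  thin C (component-cong (λ u v → sym (complement-involutive G u v)) component)

-- Seinsche's theorem

record Split (G : Graph n) (W : Subset n) : Set where
  field
    left right     : Subset n
    partition      : Partition W left right
    separated      : Separated G left right
    left-nonempty  : Nonempty left
    right-nonempty : Nonempty right
open Split

swap-split : Split G W → Split G W
swap-split {G = G} S = record
  { left = right S ; right = left S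
  ; partition = swap-partition (partition S) ; separated = separated-sym G (separated S)
  ; left-nonempty = right-nonempty S ; right-nonempty = left-nonempty S }

closed-split : A ⊆ W → Closed G W A → Nonempty A → Nonempty (W ─ A) → Split G W
closed-split {A = A} {W = W} A⊆W closed nonempty nonempty′ = record
  { left = A ; right = W ─ A ; partition = P
  ; separated = λ u∈A v∈W─A uv → disjoint P (closed u∈A (right⊆ P v∈W─A) uv) v∈W─A
  ; left-nonempty = nonempty ; right-nonempty = nonempty′ }
  where P = difference-partition A⊆W

neighbourhood : Graph n → Fin n → Subset n
neighbourhood G v = tabulate (adj G v)

∈-neighbourhood⁻ : ∀ (G : Graph n) → u ∈ neighbourhood G v → Adj G v u
∈-neighbourhood⁻ {u = u} {v = v} G u∈ =
  trans (sym (lookup∘tabulate (adj G v) u)) ([]=⇒lookup u∈)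

∈-neighbourhood⁺ : ∀ (G : Graph n) → Adj G v u → u ∈ neighbourhood G v
∈-neighbourhood⁺ {v = v} {u = u} G vu =
  lookup⇒[]= u (neighbourhood G v) (trans (lookup∘tabulate (adj G v) u) vu)

x∉p-x : ∀ (p : Subset n) x → x ∉ p - x
x∉p-x p x x∈p-x = x∈p─q⇒x∉q p ⁅ x ⁆ x∈p-x (x∈⁅x⁆ x)

x∈p-y⁺ : x ∈ p → x ≢ y → x ∈ p - y
x∈p-y⁺ x∈p x≢y = x∈p∧x∉q⇒x∈p─q x∈p (x≢y⇒x∉⁅y⁆ x≢y)

isolated-split : ∀ (G : Graph n) → v ∈ W → Nonempty (W - v) →
  Empty ((W - v) ∩ neighbourhood G v) → Split G W
isolated-split {v = v} {W = W} G v∈W nonempty isolated =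
  closed-split ⁅v⁆⊆W closed (v , x∈⁅x⁆ v) nonempty
  where
  ⁅v⁆⊆W : ⁅ v ⁆ ⊆ W
  ⁅v⁆⊆W {u} u∈⁅v⁆ = subst (_∈ W) (sym (x∈⁅y⁆⇒x≡y v u∈⁅v⁆)) v∈W
  closed : Closed G W ⁅ v ⁆
  closed {u} {w} u∈⁅v⁆ w∈W uw with x∈⁅y⁆⇒x≡y v u∈⁅v⁆
  ... | refl = contradiction
    (w , x∈p∩q⁺ (x∈p-y⁺ w∈W (Adj⇒≢ G uw ∘ sym) , ∈-neighbourhood⁺ G uw)) isolated

module _ (G : Graph n) (v∈W : v ∈ W) (S : Split G (W - v)) where

  lift-closed : Closed G (W - v) A → (∀ {u} → u ∈ A → ¬ Adj G u v) → Closed G W A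
  lift-closed closed ¬Adj-v {u} {w} u∈A w∈W uw with w ≟ v
  ... | yes refl = contradiction uw (¬Adj-v u∈A)
  ... | no  w≢v  = closed u∈A (x∈p-y⁺ w∈W w≢v) uw

  W─A-nonempty : A ⊆ left S → Nonempty (W ─ A)
  W─A-nonempty A⊆left = v , x∈p∧x∉q⇒x∈p─q v∈W
    (λ v∈A → x∉p-x W v (left⊆ (partition S) (A⊆left v∈A)))

  split-avoiding : Empty (left S ∩ neighbourhood G v) → Split G W
  split-avoiding avoid = closed-split
    (p─q⊆p W ⁅ v ⁆ ∘ left⊆ (partition S))
    (lift-closed (separated-closed G (partition S) (separated S))
      λ u∈left uv → avoid (_ , x∈p∩q⁺ (u∈left , ∈-neighbourhood⁺ G (Adj-sym G uv))))
    (left-nonempty S) (W─A-nonempty id)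

  left≢right : x ∈ left S → y ∈ right S → x ≢ y
  left≢right x∈left y∈right refl = disjoint (partition S) x∈left y∈right

  left≢v : x ∈ left S → x ≢ v
  left≢v {x = x} x∈left refl = x∉p-x W x (left⊆ (partition S) x∈left)

  -- left ─ N(v) is closed: a neighbour w ∈ N(v) of some u ∈ left ─ N(v) would make
  -- u–w–v–b an induced P₄.
  split-through : IsCograph G → x ∈ left S → ¬ Adj G v x → y ∈ right S → Adj G v y → Split G W
  split-through {x = x} {y = b} cograph x∈left ¬vx b∈right vb = closed-split
    (p─q⊆p W ⁅ v ⁆ ∘ left⊆ (partition S) ∘ p─q⊆p (left S) N)
    (lift-closed closed λ u∈A uv → x∈p─q⇒x∉q _ _ u∈A (∈-neighbourhood⁺ G (Adj-sym G uv)))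
    (x , x∈p∧x∉q⇒x∈p─q x∈left (¬vx ∘ ∈-neighbourhood⁻ G))
    (W─A-nonempty (p─q⊆p (left S) N))
    where
    N = neighbourhood G v
    closed : Closed G (W - v) (left S ─ N)
    closed {u} {w} u∈A w∈W-v uw = x∈p∧x∉q⇒x∈p─q w∈left λ w∈N →
      let vw = ∈-neighbourhood⁻ G w∈N in
      cograph u w v b
        ( Adj⇒≢ G uw , left≢v u∈left , left≢right u∈left b∈right
        , left≢v w∈left , left≢right w∈left b∈right , Adj⇒≢ G vb
        , uw , Adj-sym G vw , vb
        , (λ uv → x∈p─q⇒x∉q _ _ u∈A (∈-neighbourhood⁺ G (Adj-sym G uv)))
        , separated S u∈left b∈right , separated S w∈left b∈right )
      where
      u∈left = p─q⊆p (left S) N u∈A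
      w∈left = separated-closed G (partition S) (separated S) u∈left w∈W-v uw

extend-split : ∀ (G : Graph n) → IsCograph G → v ∈ W → x ∈ W - v → ¬ Adj G v x →
               Split G (W - v) → Split G W
extend-split {v = v} G cograph v∈W x∈W-v ¬vx S
  with nonempty? (left S ∩ neighbourhood G v) | nonempty? (right S ∩ neighbourhood G v)
... | no avoid | _        = split-avoiding G v∈W S avoid
... | _        | no avoid = split-avoiding G v∈W (swap-split S) avoid
... | yes (a , a∈) | yes (b , b∈) with cover (partition S) x∈W-v
...   | inj₁ x∈left  = split-through G v∈W S cograph x∈left ¬vx
                         (proj₁ (x∈p∩q⁻ _ _ b∈)) (∈-neighbourhood⁻ G (proj₂ (x∈p∩q⁻ _ _ b∈)))
...   | inj₂ x∈right = split-through G v∈W (swap-split S) cograph x∈right ¬vx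
                         (proj₁ (x∈p∩q⁻ _ _ a∈)) (∈-neighbourhood⁻ G (proj₂ (x∈p∩q⁻ _ _ a∈)))

_⊏_ : Subset n → Subset n → Set
A ⊏ B = ∣ A ∣ < ∣ B ∣

⊏-wellFounded : WellFounded (_⊏_ {n})
⊏-wellFounded = On.wellFounded ∣_∣ <-wellFounded

cograph-split : ∀ (G : Graph n) → IsCograph G → Acc _⊏_ W → v ∈ W → u ∈ W → v ≢ u →
                Split G W ⊎ Split (complement G) W
cograph-split {W = W} {v = v} {u = u} G cograph (acc smaller) v∈W u∈W v≢u
  with nonempty? ((W - v) ∩ neighbourhood G v)
     | nonempty? ((W - v) ∩ neighbourhood (complement G) v)
... | no isolated | _ = inj₁ (isolated-split G v∈W (u , x∈p-y⁺ u∈W (v≢u ∘ sym)) isolated)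
... | _ | no isolated =
  inj₂ (isolated-split (complement G) v∈W (u , x∈p-y⁺ u∈W (v≢u ∘ sym)) isolated)
... | yes (y , y∈) | yes (x , x∈) =
  Sum.map (extend-split G cograph v∈W x∈W-v (proj₂ (complement-Adj⁻ G v̄x)))
               (extend-split (complement G) (complement-cograph G cograph) v∈W y∈W-v
                  λ v̄y → proj₂ (complement-Adj⁻ G v̄y) vy)
               (cograph-split G cograph (smaller (x∈p⇒∣p-x∣<∣p∣ v∈W)) x∈W-v y∈W-v x≢y)
  where
  x∈W-v = proj₁ (x∈p∩q⁻ _ _ x∈)
  y∈W-v = proj₁ (x∈p∩q⁻ _ _ y∈)
  v̄x = ∈-neighbourhood⁻ (complement G) (proj₂ (x∈p∩q⁻ _ _ x∈))
  vy = ∈-neighbourhood⁻ G (proj₂ (x∈p∩q⁻ _ _ y∈))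
  x≢y : x ≢ y
  x≢y refl = proj₂ (complement-Adj⁻ G v̄x) vy

-- Balanced removal

record BalancedRemoval (α a b y : ℕ) : Set where
  field
    kept₁ removed₁ kept₂ removed₂ : ℕ
    split₁   : kept₁ + removed₁ ≡ a
    split₂   : kept₂ + removed₂ ≡ b
    removed  : removed₁ + removed₂ ≡ y
    balance₁ : kept₁ ≤ kept₂ + α
    balance₂ : kept₂ ≤ kept₁ + α

kept+removed : ∀ {α a b y} (R : BalancedRemoval α a b y) →
  let open BalancedRemoval R in kept₁ + kept₂ + y ≡ a + b
kept+removed {a = a} {b} {y} R = begin
  kept₁ + kept₂ + y                      ≡⟨ cong (kept₁ + kept₂ +_) (sym removed) ⟩
  kept₁ + kept₂ + (removed₁ + removed₂)  ≡⟨ interchange kept₁ kept₂ removed₁ removed₂ ⟩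
  kept₁ + removed₁ + (kept₂ + removed₂)  ≡⟨ cong₂ _+_ split₁ split₂ ⟩
  a + b                                  ∎
  where open BalancedRemoval R
        open ≡-Reasoning

remove-from₁ : ∀ {α a b y} → BalancedRemoval α a b y → BalancedRemoval α (suc a) b (suc y)
remove-from₁ R = record
  { kept₁ = kept₁ ; removed₁ = suc removed₁ ; kept₂ = kept₂ ; removed₂ = removed₂
  ; split₁ = trans (+-suc kept₁ removed₁) (cong suc split₁) ; split₂ = split₂
  ; removed = cong suc removed ; balance₁ = balance₁ ; balance₂ = balance₂ }
  where open BalancedRemoval R

remove-from₂ : ∀ {α a b y} → BalancedRemoval α a b y → BalancedRemoval α a (suc b) (suc y)
remove-from₂ R = record
  { kept₁ = kept₁ ; removed₁ = removed₁ ; kept₂ = kept₂ ; removed₂ = suc removed₂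
  ; split₁ = split₁ ; split₂ = trans (+-suc kept₂ removed₂) (cong suc split₂)
  ; removed = trans (+-suc removed₁ removed₂) (cong suc removed)
  ; balance₁ = balance₁ ; balance₂ = balance₂ }
  where open BalancedRemoval R

m≤1+n⇒m≤o+n+p : ∀ {m n p} o → 1 ≤ p → m ≤ suc n → m ≤ o + n + p
m≤1+n⇒m≤o+n+p {n = n} {p} o 1≤p m≤1+n = ≤-trans m≤1+n
  (≤-trans (subst (_≤ n + p) (+-comm n 1) (+-monoʳ-≤ n 1≤p)) (+-monoˡ-≤ p (m≤n+m n o)))

balanced-removal : ∀ {α} → 1 ≤ α → ∀ y a b → y ≤ a + b → a ≤ y + b + α → b ≤ y + a + α →
                   BalancedRemoval α a b y
balanced-removal _ zero a b _ a≤ b≤ = record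
  { kept₁ = a ; removed₁ = 0 ; kept₂ = b ; removed₂ = 0
  ; split₁ = +-identityʳ a ; split₂ = +-identityʳ b ; removed = refl
  ; balance₁ = a≤ ; balance₂ = b≤ }
balanced-removal 1≤α (suc y) a b y≤ a≤ b≤ with ≤-total b a
balanced-removal 1≤α (suc y) zero    zero    () a≤ b≤ | _
balanced-removal 1≤α (suc y) (suc a) b       y≤ a≤ b≤ | inj₁ b≤1+a =
  remove-from₁ (balanced-removal 1≤α y a b (≤-pred y≤) (≤-pred a≤) (m≤1+n⇒m≤o+n+p y 1≤α b≤1+a))
balanced-removal 1≤α (suc y) a       (suc b) y≤ a≤ b≤ | inj₂ a≤1+b =
  remove-from₂ (balanced-removal 1≤α y a b (≤-pred (subst (suc y ≤_) (+-suc a b) y≤))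
                                 (m≤1+n⇒m≤o+n+p y 1≤α a≤1+b) (≤-pred b≤))
balanced-removal 1≤α (suc y) zero    (suc b) y≤ a≤ b≤ | inj₁ ()
balanced-removal 1≤α (suc y) (suc a) zero    y≤ a≤ b≤ | inj₂ ()

m≤n⇒m≤o+n+p : ∀ {m n} o p → m ≤ n → m ≤ o + n + p
m≤n⇒m≤o+n+p {n = n} o p m≤n = ≤-trans m≤n (≤-trans (m≤n+m n o) (m≤m+n (o + n) p))

-- The witness is max(δ, a − b − α).
removal-size-≥ : ∀ {α β γ δ a b} → γ < α → δ < β → γ + δ ≤ a + b → a ≤ β + b + α → b ≤ a →
  ∃ λ y → δ ≤ y × y ≤ β × γ + y ≤ a + b × a ≤ y + b + α × b ≤ y + a + α
removal-size-≥ {α} {β} {γ} {δ} {a} {b} γ<α δ<β γ+δ≤ a≤ b≤a with a ≤? δ + b + α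
... | yes a≤′ = δ , ≤-refl , <⇒≤ δ<β , γ+δ≤ , a≤′ , m≤n⇒m≤o+n+p δ α b≤a
... | no a≰ = r , <⇒≤ δ<r , r≤β , γ+r≤ , ≤-reflexive (sym r+b+α≡a) , m≤n⇒m≤o+n+p r α b≤a
  where
  b+α≤a : b + α ≤ a
  b+α≤a = ≤-trans (+-monoˡ-≤ α (m≤n+m b δ)) (<⇒≤ (≰⇒> a≰))
  r = proj₁ (m≤n⇒∃[o]m+o≡n b+α≤a)
  r+b+α≡a : r + b + α ≡ a
  r+b+α≡a = trans (trans (+-assoc r b α) (+-comm r (b + α))) (proj₂ (m≤n⇒∃[o]m+o≡n b+α≤a))
  δ<r : δ < r
  δ<r = +-cancelʳ-< b δ r (+-cancelʳ-< α (δ + b) (r + b)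
          (subst (δ + b + α <_) (sym r+b+α≡a) (≰⇒> a≰)))
  r≤β : r ≤ β
  r≤β = +-cancelʳ-≤ b r β (+-cancelʳ-≤ α (r + b) (β + b) (subst (_≤ β + b + α) (sym r+b+α≡a) a≤))
  γ+r≤ : γ + r ≤ a + b
  γ+r≤ = begin
    γ + r      ≤⟨ +-monoˡ-≤ r (<⇒≤ γ<α) ⟩
    α + r      ≡⟨ +-comm α r ⟩
    r + α      ≤⟨ +-monoˡ-≤ α (m≤m+n r b) ⟩
    r + b + α  ≡⟨ r+b+α≡a ⟩
    a          ≤⟨ m≤m+n a b ⟩
    a + b      ∎
    where open ≤-Reasoning

removal-size : ∀ {α β γ δ a b} → γ < α → δ < β → γ + δ ≤ a + b →
  a ≤ β + b + α → b ≤ β + a + α →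
  ∃ λ y → δ ≤ y × y ≤ β × γ + y ≤ a + b × a ≤ y + b + α × b ≤ y + a + α
removal-size {γ = γ} {δ} {a} {b} γ<α δ<β γ+δ≤ a≤ b≤ with ≤-total b a
... | inj₁ b≤a = removal-size-≥ γ<α δ<β γ+δ≤ a≤ b≤a
... | inj₂ a≤b with removal-size-≥ γ<α δ<β (subst (γ + δ ≤_) (+-comm a b) γ+δ≤) b≤ a≤b
...   | y , δ≤y , y≤β , γ+y≤ , b≤′ , a≤′ =
  y , δ≤y , y≤β , subst (γ + y ≤_) (+-comm b a) γ+y≤ , a≤′ , b≤′

-- Thin–thick partitions

record ThinThickPartition (G : Graph n) (W : Subset n) (α β γ δ : ℕ) : Set where
  field
    thin-part thick-part : Subset n
    parts                : Partition W thin-part thick-part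
    thin                 : ThinBy α G thin-part
    thick                : ThinBy β (complement G) thick-part
    γ≤∣thin-part∣        : γ ≤ ∣ thin-part ∣
    δ≤∣thick-part∣       : δ ≤ ∣ thick-part ∣

Solvable : Graph n → Subset n → Set
Solvable G W = ∀ {α β γ δ} → γ < α → δ < β → γ + δ ≤ ∣ W ∣ → ThinThickPartition G W α β γ δ

swap-thin-thick : ∀ {α β γ δ} (G : Graph n) →
  ThinThickPartition (complement G) W β α δ γ → ThinThickPartition G W α β γ δ
swap-thin-thick G T = record
  { thin-part = thick-part ; thick-part = thin-part ; parts = swap-partition parts
  ; thin = thinBy-complement-involutive G thick ; thick = thin
  ; γ≤∣thin-part∣ = δ≤∣thick-part∣ ; δ≤∣thick-part∣ = γ≤∣thin-part∣ }
  where open ThinThickPartition T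

thin-bound : ∀ {c k k′ α} → c ≤ k → k ≤ k′ + α → 2 * c ≤ k + k′ + α
thin-bound {c} {k} {k′} {α} c≤k k≤ =
  subst (2 * c ≤_) (sym (+-assoc k k′ α)) (2*m≤n+o c≤k (≤-trans c≤k k≤))

balanced-thin-thick : ∀ {α β γ δ} (G : Graph n) → Partition W A B → Separated G A B →
  ∣ A ∣ ≤ β + ∣ B ∣ + α → ∣ B ∣ ≤ β + ∣ A ∣ + α →
  γ < α → δ < β → γ + δ ≤ ∣ W ∣ → ThinThickPartition G W α β γ δ
balanced-thin-thick {W = W} {A} {B} {α} {β} {γ} {δ} G P sep A≤ B≤ γ<α δ<β γ+δ≤
  with removal-size γ<α δ<β (subst (γ + δ ≤_) (sym (partition-size P)) γ+δ≤) A≤ B≤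
... | y , δ≤y , y≤β , γ+y≤ , A≤′ , B≤′
  with balanced-removal (≤-trans (s≤s z≤n) γ<α) y ∣ A ∣ ∣ B ∣ (m+n≤o⇒n≤o γ γ+y≤) A≤′ B≤′
... | R
  with partition-of-sizes A (kept₁ R) (removed₁ R) (split₁ R)
     | partition-of-sizes B (kept₂ R) (removed₂ R) (split₂ R)
  where open BalancedRemoval
... | XA , YA , PA , ∣XA∣≡ , ∣YA∣≡ | XB , YB , PB , ∣XB∣≡ , ∣YB∣≡ = record
  { thin-part = XA ∪ XB ; thick-part = YA ∪ YB ; parts = merge-partitions P PA PB
  ; thin = thinBy-separated G (union-partition XA∩XB≡∅)
      (λ u∈XA v∈XB → sep (left⊆ PA u∈XA) (left⊆ PB v∈XB))
      (λ C component → subst (λ m → 2 * ∣ C ∣ ≤ m + α) (sym ∣X∣≡)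
         (thin-bound (subst (∣ C ∣ ≤_) ∣XA∣≡ (component-size component)) balance₁))
      (λ C component → subst (λ m → 2 * ∣ C ∣ ≤ m + α) (sym (trans ∣X∣≡ (+-comm kept₁ kept₂)))
         (thin-bound (subst (∣ C ∣ ≤_) ∣XB∣≡ (component-size component)) balance₂))
  ; thick = thinBy-small (complement G) (subst (_≤ β) (sym ∣Y∣≡) y≤β)
  ; γ≤∣thin-part∣ = subst (γ ≤_) (sym ∣X∣≡)
      (+-cancelʳ-≤ y γ (kept₁ + kept₂) (subst (γ + y ≤_) (sym (kept+removed R)) γ+y≤))
  ; δ≤∣thick-part∣ = subst (δ ≤_) (sym ∣Y∣≡) δ≤y }
  where
  open BalancedRemoval R
  XA∩XB≡∅ : ∀ {x} → x ∈ XA → x ∉ XB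
  XA∩XB≡∅ x∈XA x∈XB = disjoint P (left⊆ PA x∈XA) (left⊆ PB x∈XB)
  ∣X∣≡ : ∣ XA ∪ XB ∣ ≡ kept₁ + kept₂
  ∣X∣≡ = trans (disjoint-union-size XA∩XB≡∅) (cong₂ _+_ ∣XA∣≡ ∣XB∣≡)
  ∣Y∣≡ : ∣ YA ∪ YB ∣ ≡ y
  ∣Y∣≡ = trans (disjoint-union-size λ x∈YA x∈YB → disjoint P (right⊆ PA x∈YA) (right⊆ PB x∈YB))
               (trans (cong₂ _+_ ∣YA∣≡ ∣YB∣≡) removed)

small-thin-thick : ∀ {α β γ δ} (G : Graph n) → ∣ W ∣ ≤ β + α →
  γ < α → δ < β → γ + δ ≤ ∣ W ∣ → ThinThickPartition G W α β γ δ
small-thin-thick {n = n} {W = W} {α} {β} G small =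
  balanced-thin-thick G trivial-partition (λ _ v∈⊥ _ → ∉⊥ v∈⊥) ∣W∣≤ ∣⊥∣≤
  where
  ∣W∣≤ : ∣ W ∣ ≤ β + ∣ ⊥ {n} ∣ + α
  ∣W∣≤ = subst (λ m → ∣ W ∣ ≤ β + m + α) (sym (∣⊥∣≡0 n))
               (subst (λ m → ∣ W ∣ ≤ m + α) (sym (+-identityʳ β)) small)
  ∣⊥∣≤ : ∣ ⊥ {n} ∣ ≤ β + ∣ W ∣ + α
  ∣⊥∣≤ = subst (_≤ β + ∣ W ∣ + α) (sym (∣⊥∣≡0 n)) z≤n

dominant-budget : ∀ {α β γ δ k r} → β + r + α < k → γ < α → δ < β → γ + r + δ ≤ k
dominant-budget {α} {β} {γ} {δ} {k} {r} large γ<α δ<β = begin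
  γ + r + δ    ≤⟨ +-mono-≤ (+-monoˡ-≤ r (<⇒≤ γ<α)) (<⇒≤ δ<β) ⟩
  α + r + β    ≡⟨ +-comm (α + r) β ⟩
  β + (α + r)  ≡⟨ cong (β +_) (+-comm α r) ⟩
  β + (r + α)  ≡⟨ +-assoc β r α ⟨
  β + r + α    ≤⟨ <⇒≤ large ⟩
  k            ∎
  where open ≤-Reasoning

-- Solving A with slack α + ∣B∣ and demand γ + ∣B∣ makes its thin part X₁ at least as large as B,
-- so B can be added to the thin part wholesale.
dominant-thin-thick : ∀ {α β γ δ} (G : Graph n) → Partition W A B → Separated G A B →
  β + ∣ B ∣ + α < ∣ A ∣ → Solvable G A → γ < α → δ < β → ThinThickPartition G W α β γ δ
dominant-thin-thick {A = A} {B} {α} {β} {γ} {δ} G P sep large solve-A γ<α δ<β = record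
  { thin-part = B ∪ X₁ ; thick-part = thick-part T
  ; parts = refine-partition (swap-partition P) (parts T)
  ; thin = thinBy-separated G (union-partition B∩X₁≡∅)
      (λ u∈B v∈X₁ → separated-sym G sep u∈B (left⊆ (parts T) v∈X₁))
      (λ C component → subst (λ m → 2 * ∣ C ∣ ≤ m + α) (sym ∣B∪X₁∣≡)
         (thin-bound (component-size component) (≤-trans ∣B∣≤∣X₁∣ (m≤m+n ∣ X₁ ∣ α))))
      (λ C component → subst (λ m → 2 * ∣ C ∣ ≤ m + α) (sym ∣B∪X₁∣≡)
         (subst (2 * ∣ C ∣ ≤_) rearrange (thin T C component)))
  ; thick = thick T
  ; γ≤∣thin-part∣ = subst (γ ≤_) (sym ∣B∪X₁∣≡)
      (≤-trans (m≤m+n γ ∣ B ∣) (≤-trans (γ≤∣thin-part∣ T) (m≤n+m ∣ X₁ ∣ ∣ B ∣)))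
  ; δ≤∣thick-part∣ = δ≤∣thick-part∣ T }
  where
  open ThinThickPartition
  T = solve-A (+-monoˡ-< ∣ B ∣ γ<α) δ<β (dominant-budget large γ<α δ<β)
  X₁ = thin-part T
  B∩X₁≡∅ : ∀ {x} → x ∈ B → x ∉ X₁
  B∩X₁≡∅ x∈B x∈X₁ = disjoint P (left⊆ (parts T) x∈X₁) x∈B
  ∣B∪X₁∣≡ : ∣ B ∪ X₁ ∣ ≡ ∣ B ∣ + ∣ X₁ ∣
  ∣B∪X₁∣≡ = disjoint-union-size B∩X₁≡∅
  ∣B∣≤∣X₁∣ : ∣ B ∣ ≤ ∣ X₁ ∣
  ∣B∣≤∣X₁∣ = m+n≤o⇒n≤o γ (γ≤∣thin-part∣ T)
  rearrange : ∣ X₁ ∣ + (α + ∣ B ∣) ≡ ∣ B ∣ + ∣ X₁ ∣ + α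
  rearrange = begin
    ∣ X₁ ∣ + (α + ∣ B ∣)  ≡⟨ cong (∣ X₁ ∣ +_) (+-comm α ∣ B ∣) ⟩
    ∣ X₁ ∣ + (∣ B ∣ + α)  ≡⟨ +-assoc ∣ X₁ ∣ ∣ B ∣ α ⟨
    ∣ X₁ ∣ + ∣ B ∣ + α    ≡⟨ cong (_+ α) (+-comm ∣ X₁ ∣ ∣ B ∣) ⟩
    ∣ B ∣ + ∣ X₁ ∣ + α    ∎
    where open ≡-Reasoning

split-solvable : ∀ (G : Graph n) → Split G W → (∀ {V} → V ⊏ W → Solvable G V) → Solvable G W
split-solvable G S solve-smaller {α} {β} γ<α δ<β γ+δ≤
  with ∣ left S ∣ ≤? β + ∣ right S ∣ + α | ∣ right S ∣ ≤? β + ∣ left S ∣ + α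
... | no left-large | _ = dominant-thin-thick G (partition S) (separated S) (≰⇒> left-large)
  (solve-smaller (partition-shrinks (partition S) (right-nonempty S))) γ<α δ<β
... | _ | no right-large = dominant-thin-thick G (partition S′) (separated S′) (≰⇒> right-large)
  (solve-smaller (partition-shrinks (partition S′) (right-nonempty S′))) γ<α δ<β
  where S′ = swap-split S
... | yes left≤ | yes right≤ =
  balanced-thin-thick G (partition S) (separated S) left≤ right≤ γ<α δ<β γ+δ≤

solvable : ∀ (G : Graph n) → IsCograph G → Acc _⊏_ W → Solvable G W
solvable {W = W} G cograph (acc smaller) {α} {β} {γ} {δ} γ<α δ<β γ+δ≤ with ∣ W ∣ ≤? β + α
... | yes small = small-thin-thick G small γ<α δ<β γ+δ≤
... | no large with two-elements-of-size W 2≤∣W∣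
  where
  2≤∣W∣ : 2 ≤ ∣ W ∣
  2≤∣W∣ = begin
    2              ≤⟨ +-mono-≤ (s≤s z≤n) (s≤s z≤n) ⟩
    suc δ + suc γ  ≤⟨ +-mono-≤ δ<β γ<α ⟩
    β + α          <⟨ ≰⇒> large ⟩
    ∣ W ∣          ∎
    where open ≤-Reasoning
...   | u , v , u∈W , v∈W , u≢v with cograph-split G cograph (acc smaller) u∈W v∈W u≢v
...     | inj₁ S = split-solvable G S (λ V⊏W → solvable G cograph (smaller V⊏W)) γ<α δ<β γ+δ≤
...     | inj₂ S = swap-thin-thick G (split-solvable (complement G) S
          (λ V⊏W → solvable (complement G) (complement-cograph G cograph) (smaller V⊏W))
          δ<β γ<α (subst (_≤ ∣ W ∣) (+-comm γ δ) γ+δ≤))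

mainTheorem14 : ∀ {n : ℕ} (G : Graph n) → IsCograph G →
    Σ (Subset n) (λ X → Thin G X × Thick G (∁ X))
mainTheorem14 G cograph =
  thin-part T , thin T , subst (ThinBy 1 (complement G)) (partition-⊤ (parts T)) (thick T)
  where
  open ThinThickPartition
  T = solvable G cograph (⊏-wellFounded ⊤) {1} {1} {0} {0} (s≤s z≤n) (s≤s z≤n) z≤n
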